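{- Let $\delta,C,M$ be integers with $3\le\delta<\infty$, $2\delta+2\le C\le3\delta+1$ and $\lceil\delta/2\rceil\le M\le\frac{C-\delta-1}{2}$, and let $\mathfrak M^\delta_{M,C}=(\{1,\dots,\delta\},\oplus,\preceq)$ be the magic semigroup. Let $a,b\in\{1,\dots,\delta\}$ be $\preceq$-incomparable and let $\mathbf K$ be a $\{1,\dots,\delta\}$-edge-labelled cycle whose edge labels are $a_1,\dots,a_k,b_1,\dots,b_\ell$ such that $k+\ell\ge3$, $a=a_1\oplus\dots\oplus a_k$ and $b=b_1\oplus\dots\oplus b_\ell$. Then $\mathbf K$ is a $C$-cycle.
   Context: For integers $\delta,C,M$ as in the claim, the magic operation $\oplus$ on $\{1,\dots,\delta\}$ is: $x\oplus y=|x-y|$ if $|x-y|>M$; otherwise $x\oplus y=\min(x+y,\,C-1-x-y)$ if this minimum is less than $M$; and $x\oplus y=M$ otherwise. It is commutative and associative. The natural order $\preceq$ is given by $a\preceq b$ iff $a=b$ or $b=a\oplus c$ for some $c\in\{1,\dots,\delta\}$; the magic semigroup is $\mathfrak M^\delta_{M,C}=(\{1,\dots,\delta\},\oplus,\preceq)$. A $\{1,\dots,\delta\}$-edge-labelled cycle is a cycle graph whose edges carry labels in $\{1,\dots,\delta\}$. A $C$-cycle is such a cycle whose edge labels can be listed (as a multiset) as $d_0,d_1,\dots,d_{2n},x_1,\dots,x_m$ for some $n\ge0$, $m\ge0$, with $\sum_{i=0}^{2n}d_i>n(C-1)+\sum_{i=1}^mx_i$. -}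

module Defs where

open import Data.Nat using (ℕ; zero; suc; _+_; _*_; _∸_; _≤_; _<_; _⊓_; ∣_-_∣; _<ᵇ_)
open import Data.Bool using (if_then_else_)
open import Data.List using (List; []; _∷_; _++_; foldl; length)
open import Data.Nat.ListAction using (sum)
open import Data.List.Relation.Unary.All using (All)
open import Data.List.Relation.Binary.Permutation.Propositional using (_↭_)
open import Data.Product using (Σ; ∃; _×_; _,_)
open import Data.Sum using (_⊎_)
open import Relation.Binary.PropositionalEquality using (_≡_)
open import Relation.Nullary using (¬_)

-- The magic operation on {1,…,δ} (elements represented as natural numbers).
--   x ⊕ y = |x-y|                      if |x-y| > M
--         = min(x+y, C-1-x-y)          if that minimum is < M
--         = M                          otherwise
-- Under the standing hypotheses (x,y ≤ δ, C ≥ 2δ+2) we have C-1-x-y ≥ 1,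
-- so truncated subtraction coincides with integer subtraction.
magic : (M C : ℕ) → ℕ → ℕ → ℕ
magic M C x y =
  if M <ᵇ ∣ x - y ∣ then ∣ x - y ∣
  else (if ((x + y) ⊓ (C ∸ 1 ∸ x ∸ y)) <ᵇ M then (x + y) ⊓ (C ∸ 1 ∸ x ∸ y)
        else M)

InRange : ℕ → ℕ → Set
InRange δ x = 1 ≤ x × x ≤ δ

Preceq : (δ M C : ℕ) → ℕ → ℕ → Set
Preceq δ M C a b = a ≡ b ⊎ Σ ℕ (λ c → InRange δ c × b ≡ magic M C a c)

Incomparable : (δ M C : ℕ) → ℕ → ℕ → Set
Incomparable δ M C a b = ¬ Preceq δ M C a b × ¬ Preceq δ M C b a

bigMagic : (M C : ℕ) → ℕ → List ℕ → ℕ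
bigMagic M C x₁ rest = foldl (magic M C) x₁ rest

-- A {1,…,δ}-edge-labelled cycle, given by its list of edge labels in
-- cyclic order (a cycle graph has at least 3 edges).
record LabelledCycle (δ : ℕ) : Set where
  constructor mkCycle
  field
    labels   : List ℕ
    long     : 3 ≤ length labels
    inRange  : All (InRange δ) labels

IsCCycle : {δ : ℕ} → ℕ → LabelledCycle δ → Set
IsCCycle C K =
  Σ ℕ λ n → Σ (List ℕ) λ ds → Σ (List ℕ) λ xs →
    (LabelledCycle.labels K ↭ ds ++ xs) ×
    (length ds ≡ suc (2 * n)) ×
    (n * (C ∸ 1) + sum xs < sum ds)

module Submission where

-- Write c = C - 1.  For a list L of labels and a value v
-- call L *odd-certified* for v if L can be split as D ++ X with |D| = 2n+1 and
--   n·c + ΣX + v ≤ ΣD,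
-- and *even-certified* for v if it splits with |D| = 2n and  n·c + ΣX ≤ ΣD + v.
-- The heart of the argument is an invariant of the iterated product: if
-- v = x₁ ⊕ … ⊕ xₖ then the list x₁,…,xₖ is odd-certified for v when v > M
-- and even-certified for v when v < M.  It is proved by folding in one label
-- at a time, using an additive description ("view") of each case of ⊕.
-- Second, two ⪯-incomparable elements lie strictly on opposite sides of M:
-- below M the order ⪯ is ≤, above M it is ≥, and M lies above everything.
-- Finally an odd certificate for b > M and an even certificate for a < M
-- concatenate to a split with  n·c + ΣX < ΣD, i.e. the cycle is a C-cycle.

open import Defs
open import Data.Nat using (ℕ; zero; suc; _+_; _*_; _≤_; _<_; _∸_; _⊓_; ∣_-_∣; _<ᵇ_; ⌈_/2⌉; z≤n; s≤s)
open import Data.Nat.Properties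
open import Data.Nat.ListAction using (sum)
open import Data.Nat.ListAction.Properties using (sum-++)
open import Data.Nat.Tactic.RingSolver using (solve-∀)
open import Data.Bool using (true; false)
open import Data.Empty using (⊥; ⊥-elim)
open import Data.Product using (Σ; ∃; _×_; _,_)
open import Data.Sum using (_⊎_; inj₁; inj₂)
open import Data.List using (List; []; _∷_; _++_; length; [_]; foldl)
open import Data.List.Properties using (length-++; ++-assoc)
open import Data.List.Relation.Unary.All using (All; []; _∷_)
open import Data.List.Relation.Binary.Permutation.Propositional using (_↭_; prep; ↭-refl; ↭-sym; ↭-trans; ↭-reflexive)
open import Data.List.Relation.Binary.Permutation.Propositional.Properties using (shift; shifts; ++-comm; ++⁺; ++⁺ˡ)
open import Relation.Binary.PropositionalEquality using (_≡_; refl; sym; trans; cong; cong₂; subst; subst₂)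
open import Relation.Binary.Definitions using (tri<; tri≈; tri>)
open import Relation.Nullary.Reflects using (ofʸ; ofⁿ)

summand≤ : ∀ {m n o} → m + n ≡ o → n ≤ o
summand≤ {m} eq = m+n≤o⇒n≤o m (≤-reflexive eq)

≤-split : ∀ {x y} → x ≤ y → x ≡ y ⊎ ∃ λ o → x + suc o ≡ y
≤-split x≤y with m≤n⇒∃[o]m+o≡n x≤y
... | zero  , x+0≡y = inj₁ (trans (sym (+-identityʳ _)) x+0≡y)
... | suc o , eq    = inj₂ (o , eq)

complement : ∀ c x y → x + y ≤ c → (c ∸ x ∸ y) + (x + y) ≡ c
complement c x y fits = trans (cong (_+ (x + y)) (∸-+-assoc c x y)) (m∸n+n≡m fits)

-- |x - y| ≤ M, written without truncated subtraction.
Close : ℕ → ℕ → ℕ → Set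
Close M x y = x ≤ y + M × y ≤ x + M

-- The five ways x ⊕ y can be computed, each with the facts that led to it:
-- a large gap (x ≥ y or x ≤ y), the small sum, the wrapped-around value
-- C-1-x-y, and the default value M.
data MagicView (M C x y : ℕ) : ℕ → Set where
  gapDown : ∀ {z} → M < z → y + z ≡ x → MagicView M C x y z
  gapUp   : ∀ {z} → M < z → x + z ≡ y → MagicView M C x y z
  small   : Close M x y → x + y < M → MagicView M C x y (x + y)
  wrap    : ∀ {z} → Close M x y → z < M → z + (x + y) ≡ C ∸ 1 → MagicView M C x y z
  middle  : Close M x y → M ≤ x + y → MagicView M C x y M

close : ∀ {M x y} → ∣ x - y ∣ ≤ M → Close M x y
close {M} {x} {y} d≤M =
  ≤-trans (m≤n+∣m-n∣ x y) (+-monoʳ-≤ y d≤M) , ≤-trans (m≤n+∣n-m∣ y x) (+-monoʳ-≤ x d≤M)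

gapView : ∀ {M C} x y → M < ∣ x - y ∣ → MagicView M C x y ∣ x - y ∣
gapView x y far with ≤-total y x
... | inj₁ y≤x = gapDown far (trans (cong (y +_) (m≤n⇒∣n-m∣≡n∸m y≤x)) (m+[n∸m]≡n y≤x))
... | inj₂ x≤y = gapUp far (trans (cong (x +_) (m≤n⇒∣m-n∣≡n∸m x≤y)) (m+[n∸m]≡n x≤y))

lowView : ∀ {M C} x y → Close M x y → x + y ≤ C ∸ 1 →
  (x + y) ⊓ (C ∸ 1 ∸ x ∸ y) < M → MagicView M C x y ((x + y) ⊓ (C ∸ 1 ∸ x ∸ y))
lowView {M} {C} x y cl fits low with ≤-total (x + y) (C ∸ 1 ∸ x ∸ y)
... | inj₁ s≤r rewrite m≤n⇒m⊓n≡m s≤r = small cl low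
... | inj₂ r≤s rewrite m≥n⇒m⊓n≡n r≤s = wrap cl low (complement (C ∸ 1) x y fits)

magicView : ∀ {M C} x y → x + y ≤ C ∸ 1 → MagicView M C x y (magic M C x y)
magicView {M} {C} x y fits
  with M <ᵇ ∣ x - y ∣ | <ᵇ-reflects-< M ∣ x - y ∣
... | true  | ofʸ far  = gapView x y far
... | false | ofⁿ near
  with (x + y) ⊓ (C ∸ 1 ∸ x ∸ y) <ᵇ M | <ᵇ-reflects-< ((x + y) ⊓ (C ∸ 1 ∸ x ∸ y)) M
...   | true  | ofʸ low  = lowView x y (close (≮⇒≥ near)) fits low
...   | false | ofⁿ high = middle (close (≮⇒≥ near)) (≤-trans (≮⇒≥ high) (m⊓n≤m _ _))

OddSplit : ℕ → List ℕ → ℕ → Set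
OddSplit c L v = Σ ℕ λ n → Σ (List ℕ) λ D → Σ (List ℕ) λ X →
  (L ↭ D ++ X) × (length D ≡ suc (2 * n)) × (n * c + sum X + v ≤ sum D)

EvenSplit : ℕ → List ℕ → ℕ → Set
EvenSplit c L v = Σ ℕ λ n → Σ (List ℕ) λ D → Σ (List ℕ) λ X →
  (L ↭ D ++ X) × (length D ≡ 2 * n) × (n * c + sum X ≤ sum D + v)

-- The conclusion: an odd split with strict surplus (for c = C - 1 this is
-- literally IsCCycle of a cycle with labels L).
CDecomposition : ℕ → List ℕ → Set
CDecomposition c L = Σ ℕ λ n → Σ (List ℕ) λ ds → Σ (List ℕ) λ xs →
  (L ↭ ds ++ xs) × (length ds ≡ suc (2 * n)) × (n * c + sum xs < sum ds)

oddSplit-perm : ∀ {c L L' v} → L ↭ L' → OddSplit c L v → OddSplit c L' v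
oddSplit-perm q (n , D , X , p , l , h) = n , D , X , ↭-trans (↭-sym q) p , l , h

evenSplit-perm : ∀ {c L L' v} → L ↭ L' → EvenSplit c L v → EvenSplit c L' v
evenSplit-perm q (n , D , X , p , l , h) = n , D , X , ↭-trans (↭-sym q) p , l , h

decomposition-perm : ∀ {c L L'} → L ↭ L' → CDecomposition c L' → CDecomposition c L
decomposition-perm q (n , D , X , p , l , h) = n , D , X , ↭-trans q p , l , h

push-x : ∀ y {L D X : List ℕ} → L ↭ D ++ X → y ∷ L ↭ D ++ (y ∷ X)
push-x y {D = D} {X} p = ↭-trans (prep y p) (↭-sym (shift y D X))

-- The four ways a certificate grows when one label y is added; they mirror
-- the gap and wrap cases of the view.  Adding y to X costs y of surplus:
odd-push-x : ∀ {c L y v a} → y + v ≡ a → OddSplit c L a → OddSplit c (y ∷ L) v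
odd-push-x {c} {y = y} {v} refl (n , D , X , p , l , h) =
  n , D , y ∷ X , push-x y p , l , subst (_≤ sum D) (regroup (n * c) (sum X) y v) h
  where
  regroup : ∀ A B y v → A + B + (y + v) ≡ A + (y + B) + v
  regroup = solve-∀

-- adding y = a + v to an even D turns a deficit a into a surplus v:
even-push-d : ∀ {c L y v a} → a + v ≡ y → EvenSplit c L a → OddSplit c (y ∷ L) v
even-push-d {c} {v = v} {a} refl (n , D , X , p , l , h) =
  n , (a + v) ∷ D , X , prep (a + v) p , cong suc l ,
  subst (n * c + sum X + v ≤_) (regroup (sum D) a v) (+-monoˡ-≤ v h)
  where
  regroup : ∀ S a v → S + a + v ≡ (a + v) + S
  regroup = solve-∀

-- adding y to X enlarges the allowed deficit by y:
even-push-x : ∀ {c L y a} → EvenSplit c L a → EvenSplit c (y ∷ L) (a + y)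
even-push-x {c} {y = y} {a} (n , D , X , p , l , h) =
  n , D , y ∷ X , push-x y p , l ,
  subst₂ _≤_ (regroupˡ (n * c) (sum X) y) (+-assoc (sum D) a y) (+-monoˡ-≤ y h)
  where
  regroupˡ : ∀ A B y → A + B + y ≡ A + (y + B)
  regroupˡ = solve-∀

-- adding y to an odd D pays one more c, leaving deficit r = c - a - y:
odd-push-d : ∀ {c L y a r} → r + (a + y) ≡ c → OddSplit c L a → EvenSplit c (y ∷ L) r
odd-push-d {y = y} {a} {r} refl (n , D , X , p , l , h) =
  suc n , y ∷ D , X , prep y p , trans (cong suc l) (double n) ,
  subst₂ _≤_ (regroupˡ (n * (r + (a + y))) (sum X) a r y) (regroupʳ (sum D) r y) (+-monoˡ-≤ (r + y) h)
  where
  double : ∀ n → suc (suc (2 * n)) ≡ 2 * suc n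
  double = solve-∀
  regroupˡ : ∀ A B a r y → A + B + a + (r + y) ≡ r + (a + y) + A + B
  regroupˡ = solve-∀
  regroupʳ : ∀ S r y → S + (r + y) ≡ y + S + r
  regroupʳ = solve-∀

odd-even-decomposition : ∀ {c L₁ L₂ v₁ v₂} → OddSplit c L₁ v₁ → EvenSplit c L₂ v₂ →
  v₂ < v₁ → CDecomposition c (L₁ ++ L₂)
odd-even-decomposition {c} {v₁ = v₁} {v₂} (n₁ , D₁ , X₁ , p₁ , l₁ , h₁) (n₂ , D₂ , X₂ , p₂ , l₂ , h₂) v₂<v₁ =
  n₁ + n₂ , D₁ ++ D₂ , X₁ ++ X₂ ,
  ↭-trans (++⁺ p₁ p₂) middle-swap ,
  trans (length-++ D₁) (trans (cong₂ _+_ l₁ l₂) (parity n₁ n₂)) ,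
  subst₂ _<_ (cong ((n₁ + n₂) * c +_) (sym (sum-++ X₁ X₂))) (sym (sum-++ D₁ D₂)) strict
  where
  middle-swap : (D₁ ++ X₁) ++ (D₂ ++ X₂) ↭ (D₁ ++ D₂) ++ (X₁ ++ X₂)
  middle-swap = ↭-trans (↭-reflexive (++-assoc D₁ X₁ (D₂ ++ X₂)))
    (↭-trans (++⁺ˡ D₁ (shifts X₁ D₂)) (↭-reflexive (sym (++-assoc D₁ D₂ (X₁ ++ X₂)))))
  parity : ∀ a b → suc (2 * a) + 2 * b ≡ suc (2 * (a + b))
  parity = solve-∀
  regroupˡ : ∀ n₁ n₂ c x₁ x₂ v₁ → (n₁ + n₂) * c + (x₁ + x₂) + v₁ ≡ (n₁ * c + x₁ + v₁) + (n₂ * c + x₂)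
  regroupˡ = solve-∀
  strict : (n₁ + n₂) * c + (sum X₁ + sum X₂) < sum D₁ + sum D₂
  strict = +-cancelʳ-< v₁ _ _ (subst₂ _<_ (sym (regroupˡ n₁ n₂ c (sum X₁) (sum X₂) v₁)) (sym (+-assoc (sum D₁) (sum D₂) v₁))
    (≤-<-trans (+-mono-≤ h₁ h₂) (+-monoʳ-< (sum D₁) (+-monoʳ-< (sum D₂) v₂<v₁))))

-- The rest of the argument takes place under the standing inequalities
-- δ ≤ 2M, 2M + δ ≤ C - 1 and M ≤ δ, which follow from the hypotheses.
module Standing (δ C M : ℕ) (δ≤M+M : δ ≤ M + M) (room : M + (M + δ) ≤ C ∸ 1) (M≤δ : M ≤ δ) where

  c : ℕ
  c = C ∸ 1

  -- Two labels always fit below c, so the view of ⊕ applies.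
  view : ∀ x y → x + y ≤ δ + δ → MagicView M C x y (magic M C x y)
  view x y s≤2δ = magicView {M} {C} x y
    (≤-trans s≤2δ (≤-trans (+-monoˡ-≤ δ δ≤M+M) (≤-trans (≤-reflexive (+-assoc M M δ)) room)))

  wrap-large : ∀ {z s} → z < M → z + s ≡ c → M + δ < s
  wrap-large {z} {s} z<M eq = +-cancelˡ-< M (M + δ) s
    (≤-<-trans room (subst (_< M + s) eq (+-monoˡ-< s z<M)))

  gap-large : ∀ {w z v} → M < z → w + z ≡ v → M < v
  gap-large M<z eq = <-≤-trans M<z (summand≤ eq)

  view≤δ : ∀ {a y z} → a ≤ δ → y ≤ δ → MagicView M C a y z → z ≤ δ
  view≤δ a≤δ _   (gapDown _ eq) = ≤-trans (summand≤ eq) a≤δ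
  view≤δ _   y≤δ (gapUp _ eq)   = ≤-trans (summand≤ eq) y≤δ
  view≤δ _   _   (small _ s<M)  = ≤-trans (<⇒≤ s<M) M≤δ
  view≤δ _   _   (wrap _ z<M _) = ≤-trans (<⇒≤ z<M) M≤δ
  view≤δ _   _   (middle _ _)   = M≤δ

  magic≤δ : ∀ {a y} → a ≤ δ → y ≤ δ → magic M C a y ≤ δ
  magic≤δ {a} {y} a≤δ y≤δ = view≤δ a≤δ y≤δ (view a y (+-mono-≤ a≤δ y≤δ))

  Certified : List ℕ → ℕ → Set
  Certified L v = (M < v → OddSplit c L v) × (v < M → EvenSplit c L v)

  certified-perm : ∀ {L L' v} → L ↭ L' → Certified L v → Certified L' v
  certified-perm q (odd , even) = (λ M<v → oddSplit-perm q (odd M<v)) , (λ v<M → evenSplit-perm q (even v<M))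

  above : ∀ {L v} → M < v → OddSplit c L v → Certified L v
  above M<v odd = (λ _ → odd) , (λ v<M → ⊥-elim (<-asym M<v v<M))

  below : ∀ {L v} → v < M → EvenSplit c L v → Certified L v
  below v<M even = (λ M<v → ⊥-elim (<-asym M<v v<M)) , (λ _ → even)

  at-M : ∀ {L} → Certified L M
  at-M = (λ M<M → ⊥-elim (<-irrefl refl M<M)) , (λ M<M → ⊥-elim (<-irrefl refl M<M))

  certified-single : ∀ x → Certified [ x ] x
  certified-single x = (λ _ → 0 , [ x ] , [] , ↭-refl , refl , m≤m+n x 0)
                     , (λ _ → 0 , [] , [ x ] , ↭-refl , refl , ≤-reflexive (+-identityʳ x))

  certified-view : ∀ {L a y z} → y ≤ δ → MagicView M C a y z → Certified L a → Certified (y ∷ L) z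
  certified-view _ (gapDown M<z eq) (odd , _) = above M<z (odd-push-x eq (odd (gap-large M<z eq)))
  certified-view {a = a} {y} y≤δ (gapUp M<z eq) (_ , even) = above M<z (even-push-d eq (even a<M))
    where
    open ≤-Reasoning
    a<M : a < M
    a<M = +-cancelʳ-< M a M (begin-strict
      a + M  <⟨ +-monoʳ-< a M<z ⟩
      _      ≡⟨ eq ⟩
      y      ≤⟨ ≤-trans y≤δ δ≤M+M ⟩
      M + M  ∎)
  certified-view {a = a} {y} _ (small _ s<M) (_ , even) = below s<M (even-push-x (even (≤-<-trans (m≤m+n a y) s<M)))
  certified-view {a = a} y≤δ (wrap _ z<M eq) (odd , _) = below z<M (odd-push-d eq (odd M<a))
    where
    M<a : M < a
    M<a = +-cancelʳ-< δ M a (≤-trans (wrap-large z<M eq) (+-monoʳ-≤ a y≤δ))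
  certified-view _ (middle _ _) _ = at-M

  -- Folding the remaining labels into the accumulator, where L lists the
  -- labels already consumed.
  certified-foldl : ∀ {L} acc rest → acc ≤ δ → All (InRange δ) rest → Certified L acc →
                    Certified (rest ++ L) (foldl (magic M C) acc rest)
  certified-foldl acc [] _ [] cert = cert
  certified-foldl {L} acc (y ∷ ys) acc≤δ ((_ , y≤δ) ∷ ys-in) cert =
    certified-perm (shift y ys L)
      (certified-foldl (magic M C acc y) ys (magic≤δ acc≤δ y≤δ) ys-in
        (certified-view y≤δ (view acc y (+-mono-≤ acc≤δ y≤δ)) cert))

  certified-bigMagic : ∀ x xs → All (InRange δ) (x ∷ xs) → Certified (x ∷ xs) (bigMagic M C x xs)
  certified-bigMagic x xs ((_ , x≤δ) ∷ xs-in) =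
    certified-perm (++-comm xs [ x ]) (certified-foldl x xs x≤δ xs-in (certified-single x))

  straddling-decomposition : ∀ {A B a b} → (a < M × M < b) ⊎ (b < M × M < a) →
    Certified A a → Certified B b → CDecomposition c (A ++ B)
  straddling-decomposition {A} {B} (inj₁ (a<M , M<b)) (_ , evenA) (oddB , _) =
    decomposition-perm (++-comm A B) (odd-even-decomposition (oddB M<b) (evenA a<M) (<-trans a<M M<b))
  straddling-decomposition (inj₂ (b<M , M<a)) (oddA , _) (_ , evenB) =
    odd-even-decomposition (oddA M<a) (evenB b<M) (<-trans b<M M<a)

  sum-view : ∀ {x k z} → x + k < M → MagicView M C x k z → z ≡ x + k
  sum-view {x} {k} s<M (gapDown M<z eq) = ⊥-elim (<-asym (gap-large M<z eq) (≤-<-trans (m≤m+n x k) s<M))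
  sum-view {x} {k} s<M (gapUp M<z eq)   = ⊥-elim (<-asym (gap-large M<z eq) (≤-<-trans (m≤n+m k x) s<M))
  sum-view s<M (small _ _)              = refl
  sum-view s<M (wrap _ z<M eq)          = ⊥-elim (<-asym (≤-<-trans (m≤m+n M δ) (wrap-large z<M eq)) s<M)
  sum-view s<M (middle _ M≤s)           = ⊥-elim (<⇒≱ s<M M≤s)

  far-apart : ∀ {x k} → M < x → Close M (x + k) k → ⊥
  far-apart {x} {k} M<x (x+k≤k+M , _) =
    <⇒≱ M<x (+-cancelˡ-≤ k x M (subst (_≤ k + M) (+-comm x k) x+k≤k+M))

  gap-view : ∀ {x k z} → M < x → MagicView M C (x + k) k z → z ≡ x
  gap-view {x} {k} _ (gapDown _ eq) = +-cancelˡ-≡ k _ x (trans eq (+-comm x k))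
  gap-view {x} {k} M<x (gapUp M<z eq) =
    ⊥-elim (<⇒≱ (m<n+m k (≤-<-trans z≤n M<x)) (≤-trans (m≤m+n (x + k) _) (≤-reflexive eq)))
  gap-view M<x (small cl _)         = ⊥-elim (far-apart M<x cl)
  gap-view M<x (wrap cl _ _)        = ⊥-elim (far-apart M<x cl)
  gap-view M<x (middle cl _)        = ⊥-elim (far-apart M<x cl)

  reach-below-view : ∀ {b k z} → b + k ≡ M → MagicView M C b k z → z ≡ M
  reach-below-view {b} {k} e (gapDown M<z eq) = ⊥-elim (<⇒≱ (gap-large M<z eq) (≤-trans (m≤m+n b k) (≤-reflexive e)))
  reach-below-view e (gapUp M<z eq)   = ⊥-elim (<⇒≱ (gap-large M<z eq) (summand≤ e))
  reach-below-view e (small _ s<M)    = ⊥-elim (<-irrefl e s<M)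
  reach-below-view e (wrap _ z<M eq)  = ⊥-elim (m+n≮m M δ (subst (M + δ <_) e (wrap-large z<M eq)))
  reach-below-view e (middle _ _)     = refl

  reach-above-view : ∀ {b k z} → M + k ≡ b → b ≤ δ → MagicView M C b k z → z ≡ M
  reach-above-view {b} {k} e _ (gapDown _ eq) = +-cancelˡ-≡ k _ M (trans eq (trans (sym e) (+-comm M k)))
  reach-above-view {b} e _ (gapUp M<z eq) =
    ⊥-elim (<⇒≱ (<-≤-trans (m<m+n b (≤-<-trans z≤n M<z)) (≤-reflexive eq)) (summand≤ e))
  reach-above-view {b} {k} e _ (small _ s<M) =
    ⊥-elim (<⇒≱ (≤-<-trans (m≤m+n b k) s<M) (m+n≤o⇒m≤o M (≤-reflexive e)))
  reach-above-view {b} {k} e b≤δ (wrap _ z<M eq) = ⊥-elim (<⇒≱ M<k k≤M)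
    where
    M<k : M < k
    M<k = +-cancelʳ-< δ M k (<-≤-trans (wrap-large z<M eq)
            (≤-trans (+-monoˡ-≤ k b≤δ) (≤-reflexive (+-comm δ k))))
    k≤M : k ≤ M
    k≤M = +-cancelˡ-≤ M k M (≤-trans (≤-reflexive e) (≤-trans b≤δ δ≤M+M))
  reach-above-view e _ (middle _ _) = refl

  -- Below M the order ⪯ contains ≤, since x ⊕ (y - x) = y.
  ⪯-below : ∀ {x y} → x ≤ y → y < M → Preceq δ M C x y
  ⪯-below {x} x≤y y<M with ≤-split x≤y
  ... | inj₁ x≡y      = inj₁ x≡y
  ... | inj₂ (o , refl) = inj₂ (suc o , (s≤s z≤n , ≤-trans (m≤n+m (suc o) x) y≤δ) ,
                                sym (sum-view y<M (view x (suc o) (≤-trans y≤δ (m≤m+n δ δ)))))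
    where
    y≤δ : x + suc o ≤ δ
    y≤δ = ≤-trans (<⇒≤ y<M) M≤δ

  -- Above M it contains ≥, since y ⊕ (y - x) = x.
  ⪯-above : ∀ {x y} → M < x → x ≤ y → y ≤ δ → Preceq δ M C y x
  ⪯-above {x} M<x x≤y y≤δ with ≤-split x≤y
  ... | inj₁ x≡y      = inj₁ (sym x≡y)
  ... | inj₂ (o , refl) = inj₂ (suc o , (s≤s z≤n , k≤δ) ,
                                sym (gap-view M<x (view (x + suc o) (suc o) (+-mono-≤ y≤δ k≤δ))))
    where
    k≤δ : suc o ≤ δ
    k≤δ = ≤-trans (m≤n+m (suc o) x) y≤δ

  ⪯-M : ∀ {b} → b ≤ δ → Preceq δ M C b M
  ⪯-M {b} b≤δ with ≤-total b M
  ... | inj₁ b≤M with ≤-split b≤M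
  ...   | inj₁ b≡M      = inj₁ b≡M
  ...   | inj₂ (o , eq) = inj₂ (suc o , (s≤s z≤n , ≤-trans (summand≤ eq) M≤δ) ,
                                sym (reach-below-view eq (view b (suc o) b+k≤2δ)))
    where
    b+k≤2δ : b + suc o ≤ δ + δ
    b+k≤2δ = ≤-trans (≤-reflexive eq) (≤-trans M≤δ (m≤m+n δ δ))
  ⪯-M {b} b≤δ | inj₂ M≤b with ≤-split M≤b
  ...   | inj₁ M≡b      = inj₁ (sym M≡b)
  ...   | inj₂ (o , eq) = inj₂ (suc o , (s≤s z≤n , k≤δ) ,
                                sym (reach-above-view eq b≤δ (view b (suc o) (+-mono-≤ b≤δ k≤δ))))
    where
    k≤δ : suc o ≤ δ
    k≤δ = ≤-trans (summand≤ eq) b≤δ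

  incomparable-straddle : ∀ {a b} → a ≤ δ → b ≤ δ → Incomparable δ M C a b →
    (a < M × M < b) ⊎ (b < M × M < a)
  incomparable-straddle {a} {b} a≤δ b≤δ (a⋠b , b⋠a) with <-cmp a M | <-cmp b M
  ... | tri< a<M _ _ | tri> _ _ M<b = inj₁ (a<M , M<b)
  ... | tri> _ _ M<a | tri< b<M _ _ = inj₂ (b<M , M<a)
  ... | tri≈ _ a≡M _ | _ = ⊥-elim (b⋠a (subst (Preceq δ M C b) (sym a≡M) (⪯-M b≤δ)))
  ... | _ | tri≈ _ b≡M _ = ⊥-elim (a⋠b (subst (Preceq δ M C a) (sym b≡M) (⪯-M a≤δ)))
  ... | tri< a<M _ _ | tri< b<M _ _ with ≤-total a b
  ...   | inj₁ a≤b = ⊥-elim (a⋠b (⪯-below a≤b b<M))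
  ...   | inj₂ b≤a = ⊥-elim (b⋠a (⪯-below b≤a a<M))
  incomparable-straddle {a} {b} a≤δ b≤δ (a⋠b , b⋠a) | tri> _ _ M<a | tri> _ _ M<b with ≤-total a b
  ...   | inj₁ a≤b = ⊥-elim (b⋠a (⪯-above M<a a≤b b≤δ))
  ...   | inj₂ b≤a = ⊥-elim (a⋠b (⪯-above M<b b≤a a≤δ))

  incomparable-decomposition : ∀ {a b a₁ as b₁ bs} → a ≤ δ → b ≤ δ → Incomparable δ M C a b →
    All (InRange δ) (a₁ ∷ as) → All (InRange δ) (b₁ ∷ bs) →
    a ≡ bigMagic M C a₁ as → b ≡ bigMagic M C b₁ bs →
    CDecomposition c ((a₁ ∷ as) ++ (b₁ ∷ bs))
  incomparable-decomposition a≤δ b≤δ inc as-in bs-in refl refl =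
    straddling-decomposition (incomparable-straddle a≤δ b≤δ inc)
      (certified-bigMagic _ _ as-in) (certified-bigMagic _ _ bs-in)

-- The corollary: derive the standing inequalities and transport the decomposition along the cycle's labels.
corollary6p5 : (δ C M : ℕ) → 3 ≤ δ → 2 * δ + 2 ≤ C → C ≤ 3 * δ + 1 →
    ⌈ δ /2⌉ ≤ M → 2 * M + δ + 1 ≤ C →
    (a b : ℕ) → InRange δ a → InRange δ b → Incomparable δ M C a b →
    (a₁ : ℕ) (as : List ℕ) (b₁ : ℕ) (bs : List ℕ) →
    All (InRange δ) (a₁ ∷ as) → All (InRange δ) (b₁ ∷ bs) →
    3 ≤ length (a₁ ∷ as) + length (b₁ ∷ bs) →
    a ≡ bigMagic M C a₁ as → b ≡ bigMagic M C b₁ bs →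
    (K : LabelledCycle δ) → LabelledCycle.labels K ↭ (a₁ ∷ as) ++ (b₁ ∷ bs) →
    IsCCycle C K
corollary6p5 δ C M _ _ C≤3δ+1 ⌈δ/2⌉≤M 2M+δ+1≤C _ _ (_ , a≤δ) (_ , b≤δ) inc
             _ _ _ _ as-in bs-in _ a≡ b≡ _ labels↭ =
  decomposition-perm labels↭
    (Standing.incomparable-decomposition δ C M δ≤M+M room M≤δ a≤δ b≤δ inc as-in bs-in a≡ b≡)
  where
  -- δ = ⌊δ/2⌋ + ⌈δ/2⌉ ≤ 2⌈δ/2⌉ ≤ 2M.
  δ≤M+M : δ ≤ M + M
  δ≤M+M = ≤-trans (≤-reflexive (sym (⌊n/2⌋+⌈n/2⌉≡n δ)))
    (≤-trans (+-monoˡ-≤ ⌈ δ /2⌉ (⌊n/2⌋≤⌈n/2⌉ δ)) (+-mono-≤ ⌈δ/2⌉≤M ⌈δ/2⌉≤M))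
  room : M + (M + δ) ≤ C ∸ 1
  room = subst (_≤ C ∸ 1) (trans (m+n∸n≡m (2 * M + δ) 1) (twice M δ)) (∸-monoˡ-≤ 1 2M+δ+1≤C)
    where
    twice : ∀ M δ → 2 * M + δ ≡ M + (M + δ)
    twice = solve-∀
  -- 2M + δ + 1 ≤ C ≤ 3δ + 1 gives 2M ≤ 2δ.
  M≤δ : M ≤ δ
  M≤δ = *-cancelˡ-≤ 2 (+-cancelʳ-≤ (δ + 1) (2 * M) (2 * δ)
          (subst₂ _≤_ (regroup M δ) (triple δ) (≤-trans 2M+δ+1≤C C≤3δ+1)))
    where
    regroup : ∀ M δ → 2 * M + δ + 1 ≡ 2 * M + (δ + 1)
    regroup = solve-∀
    triple : ∀ δ → 3 * δ + 1 ≡ 2 * δ + (δ + 1)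
    triple = solve-∀
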